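{- A QBF $\mathcal Q.\phi$ is false if and only if the universal player has a winning strategy in the score game on $\mathcal Q.\phi$; this holds for variant 1 and for variant 2 of the score game.
   Context: A QBF $\mathcal Q.\phi$ consists of a quantifier prefix $\mathcal Q$ that quantifies each variable of a finite set $V$ of Boolean variables exactly once, existentially or universally, in a linear order, and a CNF formula $\phi$ over $V$. It is false if the universal player has a winning strategy in the evaluation game (variables assigned in the order of $\mathcal Q$, existential ones by the existential player, universal ones by the universal player; the existential player wins iff $\phi$ is satisfied). The score game on $\mathcal Q.\phi$ is played by the same two players, building a total Boolean assignment in the order of $\mathcal Q$: the existential player freely sets each existential variable; for each universal variable $u$, the universal player first announces a number $s_u\in\mathbb Q$, then the existential player sets $u$ to some $b\in\{0,1\}$, and the universal player scores $s_u(2b-1)$ points. The total score is the sum of these points. In variant 1 the universal player wins iff $\phi$ is falsified by the final assignment or the total score is strictly positive; in variant 2 the universal player wins iff $\phi$ is falsified or the total score equals $1$. -}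

module Defs where

open import Data.Nat using (ℕ)
open import Data.Fin using (Fin; _≟_)
open import Data.Bool using (Bool; true; false; if_then_else_; not)
open import Data.List using (List; []; _∷_; map)
open import Data.List.Relation.Unary.Any using (Any)
open import Data.List.Relation.Unary.Unique.Propositional using (Unique)
open import Data.List.Membership.Propositional using (_∈_)
open import Data.Product using (Σ; _×_; _,_; proj₂)
open import Data.Sum using (_⊎_)
open import Data.Empty using (⊥)
open import Data.Rational using (ℚ; 0ℚ; 1ℚ; _+_; _*_; _<_; -_)
open import Relation.Nullary using (¬_; does)
open import Relation.Binary.PropositionalEquality using (_≡_)

data Quant : Set where
  ∃q ∀q : Quant

-- A quantifier prefix over the variable set Fin n: a list of (quantifier, variable),
-- read left to right (outermost first).
Prefix : ℕ → Set
Prefix n = List (Quant × Fin n)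

WellFormedPrefix : {n : ℕ} → Prefix n → Set
WellFormedPrefix {n} Q = Unique (map proj₂ Q) × (∀ (v : Fin n) → v ∈ map proj₂ Q)

-- CNF formulas: a literal is (polarity, variable); polarity true = positive literal.
Literal : ℕ → Set
Literal n = Bool × Fin n

Clause : ℕ → Set
Clause n = List (Literal n)

CNF : ℕ → Set
CNF n = List (Clause n)

Assignment : ℕ → Set
Assignment n = Fin n → Bool

LitTrue : {n : ℕ} → Assignment n → Literal n → Set
LitTrue α (p , x) = α x ≡ p

ClauseSat : {n : ℕ} → Assignment n → Clause n → Set
ClauseSat α C = Any (LitTrue α) C

Satisfies : {n : ℕ} → Assignment n → CNF n → Set
Satisfies α φ = ∀ {C} → C ∈ φ → ClauseSat α C

_[_↦_] : {n : ℕ} → Assignment n → Fin n → Bool → Assignment n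
(α [ x ↦ b ]) y = if does (x ≟ y) then b else α y

-- initial (irrelevant) assignment; every variable is overwritten during a play
α₀ : {n : ℕ} → Assignment n
α₀ _ = false

-- A winning strategy of
-- the universal player in this finite game is exactly a choice of moves at
-- universal nodes (depending on the history) such that every play is won.

UnivWinsEval : {n : ℕ} → CNF n → Prefix n → Assignment n → Set
UnivWinsEval φ [] α = ¬ Satisfies α φ
UnivWinsEval φ ((∃q , x) ∷ Q) α = ∀ (b : Bool) → UnivWinsEval φ Q (α [ x ↦ b ])
UnivWinsEval φ ((∀q , x) ∷ Q) α = Σ Bool λ b → UnivWinsEval φ Q (α [ x ↦ b ])

QBFFalse : {n : ℕ} → Prefix n → CNF n → Set
QBFFalse Q φ = UnivWinsEval φ Q α₀

sign : Bool → ℚ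
sign true = 1ℚ
sign false = - 1ℚ

ScoreCond : Set₁
ScoreCond = ℚ → Set

variant1 : ScoreCond
variant1 s = 0ℚ < s

variant2 : ScoreCond
variant2 s = s ≡ 1ℚ

-- At a universal variable u the universal player announces s_u ∈ ℚ,
-- then the existential player chooses b, and s_u(2b-1) is added to the score.
UnivWinsScore : {n : ℕ} → ScoreCond → CNF n → Prefix n → Assignment n → ℚ → Set
UnivWinsScore W φ [] α s = (¬ Satisfies α φ) ⊎ W s
UnivWinsScore W φ ((∃q , x) ∷ Q) α s =
  ∀ (b : Bool) → UnivWinsScore W φ Q (α [ x ↦ b ]) s
UnivWinsScore W φ ((∀q , x) ∷ Q) α s =
  Σ ℚ λ su → ∀ (b : Bool) → UnivWinsScore W φ Q (α [ x ↦ b ]) (s + su * sign b)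

UnivWinsScoreGame : {n : ℕ} → ScoreCond → Prefix n → CNF n → Set
UnivWinsScoreGame W Q φ = UnivWinsScore W φ Q α₀ 0ℚ

-- If the universal player wins the evaluation game, then at each universal variable he
-- announces (1 − s)(2b̄ − 1), where s is the current score and b̄ the negation of his
-- winning move: a deviation by the existential player sets the score to exactly 1, after
-- which announcing 0 keeps it there; otherwise the play follows the winning strategy and
-- falsifies φ. Conversely, the existential player can always make s_u(2b − 1) ≤ 0, so
-- the score stays nonpositive and a winning score strategy must falsify φ along these
-- plays, which is a winning evaluation strategy. Both variants are won at score 1 and lost
-- at every nonpositive score.
module Submission where

open import Defs
open import Data.Nat using (ℕ)
open import Data.Bool using (Bool; true; false; not)
open import Data.List using ([]; _∷_)
open import Data.Product using (Σ; _×_; _,_)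
open import Data.Sum using (inj₁; inj₂)
open import Data.Rational using (0ℚ; 1ℚ; _+_; _-_; _*_; _<_; _≤_; -_)
open import Data.Rational.Properties
  using (*-assoc; *-identityʳ; *-zeroˡ; +-identityʳ; +-mono-≤; neg-antimono-≤; ≤-total;
         ≤-refl; <-irrefl; <-≤-trans; positive⁻¹)
open import Data.Rational.Solver using (module +-*-Solver)
open import Function.Bundles using (_⇔_; mk⇔)
open import Relation.Nullary using (¬_)
open import Relation.Binary.PropositionalEquality using (_≡_; refl; sym; cong; subst; module ≡-Reasoning)

sign-*-sign : ∀ b → sign b * sign b ≡ 1ℚ
sign-*-sign true  = refl
sign-*-sign false = refl

+-[1-]-*-sign-*-sign : ∀ s b → s + (1ℚ - s) * sign b * sign b ≡ 1ℚ
+-[1-]-*-sign-*-sign s b = begin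
  s + (1ℚ - s) * sign b * sign b    ≡⟨ cong (s +_) (*-assoc (1ℚ - s) (sign b) (sign b)) ⟩
  s + (1ℚ - s) * (sign b * sign b)  ≡⟨ cong (λ t → s + (1ℚ - s) * t) (sign-*-sign b) ⟩
  s + (1ℚ - s) * 1ℚ                 ≡⟨ solve 1 (λ x → x :+ (con 1ℚ :- x) :* con 1ℚ := con 1ℚ) refl s ⟩
  1ℚ                                ∎
  where
  open ≡-Reasoning
  open +-*-Solver

∃-sign-*-nonPositive : ∀ q → Σ Bool λ b → q * sign b ≤ 0ℚ
∃-sign-*-nonPositive q with ≤-total q 0ℚ
... | inj₁ q≤0 = true  , subst (_≤ 0ℚ) (sym (*-identityʳ q)) q≤0
... | inj₂ 0≤q = false , subst (_≤ 0ℚ) (sym (q*-1≡-q)) (neg-antimono-≤ 0≤q)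
  where
  open +-*-Solver
  q*-1≡-q : q * - 1ℚ ≡ - q
  q*-1≡-q = solve 1 (λ x → x :* (:- con 1ℚ) := :- x) refl q

module _ {n : ℕ} (W : ScoreCond) (φ : CNF n) where

  winningScore⇒univWinsScore : ∀ Q α s → W s → UnivWinsScore W φ Q α s
  winningScore⇒univWinsScore []             α s w = inj₂ w
  winningScore⇒univWinsScore ((∃q , x) ∷ Q) α s w b =
    winningScore⇒univWinsScore Q (α [ x ↦ b ]) s w
  winningScore⇒univWinsScore ((∀q , x) ∷ Q) α s w = 0ℚ , λ b →
    subst (UnivWinsScore W φ Q (α [ x ↦ b ])) (sym (+-0*≡ b))
      (winningScore⇒univWinsScore Q (α [ x ↦ b ]) s w)
    where
    +-0*≡ : ∀ b → s + 0ℚ * sign b ≡ s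
    +-0*≡ b = begin
      s + 0ℚ * sign b ≡⟨ cong (s +_) (*-zeroˡ (sign b)) ⟩
      s + 0ℚ          ≡⟨ +-identityʳ s ⟩
      s               ∎
      where open ≡-Reasoning

  univWinsEval⇒univWinsScore : W 1ℚ → ∀ Q α s → UnivWinsEval φ Q α → UnivWinsScore W φ Q α s
  univWinsEval⇒univWinsScore w1 []             α s ¬sat = inj₁ ¬sat
  univWinsEval⇒univWinsScore w1 ((∃q , x) ∷ Q) α s win b =
    univWinsEval⇒univWinsScore w1 Q (α [ x ↦ b ]) s (win b)
  univWinsEval⇒univWinsScore w1 ((∀q , x) ∷ Q) α s (b* , win) =
    (1ℚ - s) * sign (not b*) , reply b* win
    where
    reply : ∀ b* → UnivWinsEval φ Q (α [ x ↦ b* ]) → ∀ b →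
            UnivWinsScore W φ Q (α [ x ↦ b ]) (s + (1ℚ - s) * sign (not b*) * sign b)
    reply true  win true  = univWinsEval⇒univWinsScore w1 Q _ _ win
    reply false win false = univWinsEval⇒univWinsScore w1 Q _ _ win
    reply true  _   false = winningScore⇒univWinsScore Q _ _
                              (subst W (sym (+-[1-]-*-sign-*-sign s false)) w1)
    reply false _   true  = winningScore⇒univWinsScore Q _ _
                              (subst W (sym (+-[1-]-*-sign-*-sign s true)) w1)

  univWinsScore⇒univWinsEval : (∀ {t} → t ≤ 0ℚ → ¬ W t) →
    ∀ Q α s → s ≤ 0ℚ → UnivWinsScore W φ Q α s → UnivWinsEval φ Q α
  univWinsScore⇒univWinsEval ¬W []             α s s≤0 (inj₁ ¬sat) = ¬sat
  univWinsScore⇒univWinsEval ¬W []             α s s≤0 (inj₂ w)    with () ← ¬W s≤0 w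
  univWinsScore⇒univWinsEval ¬W ((∃q , x) ∷ Q) α s s≤0 win b =
    univWinsScore⇒univWinsEval ¬W Q (α [ x ↦ b ]) s s≤0 (win b)
  univWinsScore⇒univWinsEval ¬W ((∀q , x) ∷ Q) α s s≤0 (su , win)
    with b , su*b≤0 ← ∃-sign-*-nonPositive su =
    b , univWinsScore⇒univWinsEval ¬W Q (α [ x ↦ b ]) _ (+-mono-≤ s≤0 su*b≤0) (win b)

  univWinsEval⇔univWinsScore : W 1ℚ → (∀ {t} → t ≤ 0ℚ → ¬ W t) →
    ∀ Q → QBFFalse Q φ ⇔ UnivWinsScoreGame W Q φ
  univWinsEval⇔univWinsScore w1 ¬W Q = mk⇔
    (univWinsEval⇒univWinsScore w1 Q α₀ 0ℚ)
    (univWinsScore⇒univWinsEval ¬W Q α₀ 0ℚ ≤-refl)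

0<1 : 0ℚ < 1ℚ
0<1 = positive⁻¹ 1ℚ

¬variant1-nonPositive : ∀ {t} → t ≤ 0ℚ → ¬ variant1 t
¬variant1-nonPositive t≤0 0<t = <-irrefl refl (<-≤-trans 0<t t≤0)

¬variant2-nonPositive : ∀ {t} → t ≤ 0ℚ → ¬ variant2 t
¬variant2-nonPositive 1≤0 refl = <-irrefl refl (<-≤-trans 0<1 1≤0)

proposition3p6 : ∀ (n : ℕ) (Q : Prefix n) (φ : CNF n) → WellFormedPrefix Q →
    (QBFFalse Q φ ⇔ UnivWinsScoreGame variant1 Q φ) ×
    (QBFFalse Q φ ⇔ UnivWinsScoreGame variant2 Q φ)
proposition3p6 n Q φ _ =
  univWinsEval⇔univWinsScore variant1 φ 0<1 ¬variant1-nonPositive Q ,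
  univWinsEval⇔univWinsScore variant2 φ refl ¬variant2-nonPositive Q
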